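{- Let $m,n\ge 6$ be integers. Then $$\max\{\gamma_2^d(C_{m-1}\Box C_n),\ \gamma_2^d(C_m\Box C_{n-1})\}\le \gamma_2^d(C_m\Box C_n).$$
   Context: $C_k$ denotes the cycle on $k$ vertices. For graphs $G,H$, the Cartesian product $G\Box H$ has vertex set $V(G)\times V(H)$, with $(g,h)$ adjacent to $(g',h')$ iff either $g=g'$ and $hh'\in E(H)$, or $h=h'$ and $gg'\in E(G)$. For a graph $\Gamma$ and a vertex $v$, let $\Gamma(v)$ be the set of vertices at distance exactly $1$ from $v$ and $\Gamma_2(v)$ the set of vertices at distance exactly $2$ from $v$. A set $S\subseteq V(\Gamma)$ is a disjunctive dominating set if every vertex $v\notin S$ satisfies $|\Gamma(v)\cap S|\ge 1$ or $|\Gamma_2(v)\cap S|\ge 2$. The disjunctive domination number $\gamma_2^d(\Gamma)$ is the minimum cardinality of a disjunctive dominating set of $\Gamma$. -}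

module Defs where

open import Level using (0ℓ)
open import Data.Nat using (ℕ; zero; suc; _≤_)
open import Data.Fin using (Fin; toℕ)
open import Data.Product using (_×_; _,_; ∃; ∃-syntax)
open import Data.Sum using (_⊎_)
open import Data.List using (List; length)
open import Data.List.Membership.Propositional using (_∈_; _∉_)
open import Data.List.Relation.Unary.Unique.Propositional using (Unique)
open import Relation.Binary.PropositionalEquality using (_≡_; _≢_)
open import Relation.Nullary using (¬_)

record Graph : Set₁ where
  field
    V   : Set
    Adj : V → V → Set
open Graph public

-- The cycle C_k on vertex set Fin k = {0,…,k-1}: i ~ j iff j ≡ i ± 1 (mod k).
CycAdj : (k : ℕ) → Fin k → Fin k → Set
CycAdj k i j =
  (suc (toℕ i) ≡ toℕ j) ⊎ (suc (toℕ j) ≡ toℕ i)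
  ⊎ ((toℕ i ≡ 0) × (suc (toℕ j) ≡ k)) ⊎ ((toℕ j ≡ 0) × (suc (toℕ i) ≡ k))

C : ℕ → Graph
C k = record { V = Fin k ; Adj = CycAdj k }

_□_ : Graph → Graph → Graph
G □ H = record
  { V   = V G × V H
  ; Adj = λ { (g , h) (g' , h') →
              ((g ≡ g') × Adj H h h') ⊎ ((h ≡ h') × Adj G g g') } }

Dist1 : (Γ : Graph) → V Γ → V Γ → Set
Dist1 Γ v u = (u ≢ v) × Adj Γ v u

Dist2 : (Γ : Graph) → V Γ → V Γ → Set
Dist2 Γ v u = (u ≢ v) × (¬ Adj Γ v u) × (∃[ w ] (Adj Γ v w × Adj Γ w u))

IsDisjDom : (Γ : Graph) → List (V Γ) → Set
IsDisjDom Γ S =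
  Unique S ×
  (∀ v → v ∉ S →
     (∃[ u ] (u ∈ S × Dist1 Γ v u))
     ⊎ (∃[ u₁ ] ∃[ u₂ ] (u₁ ∈ S × u₂ ∈ S × u₁ ≢ u₂ × Dist2 Γ v u₁ × Dist2 Γ v u₂)))

IsDisjDomNumber : (Γ : Graph) → ℕ → Set
IsDisjDomNumber Γ γ =
  (∃[ S ] (IsDisjDom Γ S × length S ≡ γ)) ×
  (∀ S → IsDisjDom Γ S → γ ≤ length S)

{-# OPTIONS --safe #-}
module Submission where

-- Merging the two ends m-2, m-1 of the last edge of C_m sends every edge of C_m □ C_n to an edge or
-- to a single vertex, so the image of a disjunctive dominating set S is again one, of size at most |S|:
-- a vertex outside the image lifts to a vertex outside S, a neighbour in S maps to a neighbour, and a
-- vertex of S at distance 2 maps to one at distance 1 or 2. The two dominators at distance 2 stay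
-- distinct, because (m-2, j) and (m-1, j) are never both at distance 2 from one vertex: for m ≥ 6 the
-- ends m-2, m-1 have no common neighbour in C_m and disjoint distance-2 sets {m-4, 0} and {m-3, 1}.
-- The second factor is shrunk the same way after swapping the factors.

open import Defs
open import Data.Nat using (ℕ; zero; suc; _+_; _≤_; _<_; _∸_; _⊔_)
import Data.Nat as ℕ
open import Data.Nat.Properties using (≤-trans; ≤-reflexive; <-irrefl; ≤⇒≯; n≤1+n; 1+n≰n; ⊔-lub; m≤n⇒∃[o]m+o≡n)
open import Data.Fin using (Fin; zero; suc; toℕ; inject₁; _≟_)
open import Data.Fin.Properties using (toℕ-injective; toℕ<n)
open import Data.Product using (_×_; _,_; ∃-syntax; proj₁; proj₂; swap)
open import Data.Product.Properties using (≡-dec)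
open import Data.Sum using (_⊎_; inj₁; inj₂; fromInj₁; fromInj₂)
import Data.Sum as Sum
open import Data.Empty using (⊥; ⊥-elim)
open import Data.List using (List; length; map; deduplicate)
open import Data.List.Properties using (length-deduplicate; length-map)
open import Data.List.Membership.Propositional using (_∈_; _∉_)
open import Data.List.Membership.Propositional.Properties using (∈-deduplicate⁺; ∈-map⁺)
open import Data.List.Relation.Unary.Unique.DecPropositional.Properties using (deduplicate-!)
open import Function using (_∘_)
open import Relation.Binary.Definitions using (Decidable; DecidableEquality)
open import Relation.Binary.PropositionalEquality using (_≡_; _≢_; refl; sym; trans; cong; subst)
open import Relation.Nullary using (¬_; yes; no)
open import Relation.Nullary.Decidable using (_×-dec_; _⊎-dec_)

DisjDominated : (Γ : Graph) → List (V Γ) → V Γ → Set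
DisjDominated Γ S v =
  (∃[ u ] (u ∈ S × Dist1 Γ v u))
  ⊎ (∃[ u₁ ] ∃[ u₂ ] (u₁ ∈ S × u₂ ∈ S × u₁ ≢ u₂ × Dist2 Γ v u₁ × Dist2 Γ v u₂))

infix 4 _≼ᵈ_
_≼ᵈ_ : Graph → Graph → Set
Γ' ≼ᵈ Γ = ∀ S → IsDisjDom Γ S → ∃[ S' ] (IsDisjDom Γ' S' × length S' ≤ length S)

≼ᵈ-trans : ∀ {Γ₁ Γ₂ Γ₃} → Γ₁ ≼ᵈ Γ₂ → Γ₂ ≼ᵈ Γ₃ → Γ₁ ≼ᵈ Γ₃
≼ᵈ-trans Γ₁≼Γ₂ Γ₂≼Γ₃ S D =
  let S₂ , D₂ , |S₂|≤|S| = Γ₂≼Γ₃ S D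
      S₁ , D₁ , |S₁|≤|S₂| = Γ₁≼Γ₂ S₂ D₂
  in S₁ , D₁ , ≤-trans |S₁|≤|S₂| |S₂|≤|S|

disjDomNumber-mono : ∀ {Γ' Γ γ' γ} → Γ' ≼ᵈ Γ →
                     IsDisjDomNumber Γ' γ' → IsDisjDomNumber Γ γ → γ' ≤ γ
disjDomNumber-mono Γ'≼Γ (_ , minimal) ((S , D , refl) , _) =
  let S' , D' , |S'|≤|S| = Γ'≼Γ S D in ≤-trans (minimal S' D') |S'|≤|S|

record Contraction (Γ Γ' : Graph) : Set where
  field
    π         : V Γ → V Γ'
    σ         : V Γ' → V Γ
    π∘σ       : ∀ v → π (σ v) ≡ v
    π-adj     : ∀ {x y} → Adj Γ x y → π x ≡ π y ⊎ Adj Γ' (π x) (π y)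
    π-fibre   : ∀ {v u₁ u₂} → u₁ ≢ u₂ → π u₁ ≡ π u₂ →
                Dist2 Γ v u₁ → Dist2 Γ v u₂ → ⊥

module _ {Γ Γ' : Graph} (_≟'_ : DecidableEquality (V Γ')) (adj? : Decidable (Adj Γ'))
         (φ : Contraction Γ Γ') where
  open Contraction φ

  image : List (V Γ) → List (V Γ')
  image S = deduplicate _≟'_ (map π S)

  ∈-image : ∀ {S u} → u ∈ S → π u ∈ image S
  ∈-image = ∈-deduplicate⁺ _≟'_ ∘ ∈-map⁺ π

  length-image : ∀ S → length (image S) ≤ length S
  length-image S = ≤-trans (length-deduplicate _≟'_ (map π S)) (≤-reflexive (length-map π S))

  π-dist1 : ∀ {x u} → π u ≢ π x → Adj Γ x u → Dist1 Γ' (π x) (π u)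
  π-dist1 πu≢πx x~u = πu≢πx , fromInj₂ (⊥-elim ∘ πu≢πx ∘ sym) (π-adj x~u)

  π-dist2 : ∀ {x u} → π u ≢ π x → Dist2 Γ x u → Dist1 Γ' (π x) (π u) ⊎ Dist2 Γ' (π x) (π u)
  π-dist2 {x} {u} πu≢πx (_ , _ , w , x~w , w~u) with adj? (π x) (π u)
  ... | yes πx~πu = inj₁ (πu≢πx , πx~πu)
  ... | no ¬πx~πu with π-adj x~w | π-adj w~u
  ...   | inj₁ πx≡πw | inj₁ πw≡πu = ⊥-elim (πu≢πx (sym (trans πx≡πw πw≡πu)))
  ...   | inj₁ πx≡πw | inj₂ πw~πu = ⊥-elim (¬πx~πu (subst (λ z → Adj Γ' z (π u)) (sym πx≡πw) πw~πu))
  ...   | inj₂ πx~πw | inj₁ πw≡πu = ⊥-elim (¬πx~πu (subst (Adj Γ' (π x)) πw≡πu πx~πw))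
  ...   | inj₂ πx~πw | inj₂ πw~πu = inj₂ (πu≢πx , ¬πx~πu , π w , πx~πw , πw~πu)

  module _ {S : List (V Γ)} {x : V Γ} (πx∉ : π x ∉ image S) where
    π-outside : ∀ {u} → u ∈ S → π u ≢ π x
    π-outside u∈S πu≡πx = πx∉ (subst (_∈ image S) πu≡πx (∈-image u∈S))

    π-dominated : DisjDominated Γ S x → DisjDominated Γ' (image S) (π x)
    π-dominated (inj₁ (u , u∈S , _ , x~u)) = inj₁ (π u , ∈-image u∈S , π-dist1 (π-outside u∈S) x~u)
    π-dominated (inj₂ (u₁ , u₂ , u₁∈S , u₂∈S , u₁≢u₂ , d₁ , d₂))
      with π-dist2 (π-outside u₁∈S) d₁ | π-dist2 (π-outside u₂∈S) d₂
    ... | inj₁ e₁ | _       = inj₁ (π u₁ , ∈-image u₁∈S , e₁)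
    ... | inj₂ _  | inj₁ e₂ = inj₁ (π u₂ , ∈-image u₂∈S , e₂)
    ... | inj₂ e₁ | inj₂ e₂ =
      inj₂ (π u₁ , π u₂ , ∈-image u₁∈S , ∈-image u₂∈S , (λ πu₁≡πu₂ → π-fibre u₁≢u₂ πu₁≡πu₂ d₁ d₂) , e₁ , e₂)

  contraction⇒≼ᵈ : Γ' ≼ᵈ Γ
  contraction⇒≼ᵈ S (_ , dominated) = image S , (deduplicate-! _≟'_ (map π S) , dominated') , length-image S
    where
    dominated' : ∀ v → v ∉ image S → DisjDominated Γ' (image S) v
    dominated' v v∉ = subst (DisjDominated Γ' (image S)) (π∘σ v)
                            (π-dominated πσv∉ (dominated (σ v) (πσv∉ ∘ ∈-image)))
      where πσv∉ : π (σ v) ∉ image S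
            πσv∉ = subst (_∉ image S) (sym (π∘σ v)) v∉

data Dist2-□ (G H : Graph) : V G → V H → V G → V H → Set where
  horizontal : ∀ {a b c} → Dist2 G a c → Dist2-□ G H a b c b
  vertical   : ∀ {a b d} → Dist2 H b d → Dist2-□ G H a b a d
  diagonal   : ∀ {a b c d} → Adj G a c → Adj H b d → Dist2-□ G H a b c d

dist2-□ : ∀ {G H a b c d} → Dist2 (G □ H) (a , b) (c , d) → Dist2-□ G H a b c d
dist2-□ (cd≢ab , ¬ab~cd , _ , inj₂ (refl , a~x) , inj₂ (refl , x~c)) =
  horizontal ((cd≢ab ∘ cong (_, _)) , (¬ab~cd ∘ inj₂ ∘ (refl ,_)) , _ , a~x , x~c)
dist2-□ (cd≢ab , ¬ab~cd , _ , inj₁ (refl , b~y) , inj₁ (refl , y~d)) =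
  vertical ((cd≢ab ∘ cong (_ ,_)) , (¬ab~cd ∘ inj₁ ∘ (refl ,_)) , _ , b~y , y~d)
dist2-□ (_ , _ , _ , inj₁ (refl , b~d) , inj₂ (refl , a~c)) = diagonal a~c b~d
dist2-□ (_ , _ , _ , inj₂ (refl , a~c) , inj₁ (refl , b~d)) = diagonal a~c b~d

module _ {G G' : Graph} (H : Graph) (H-loopless : ∀ j → ¬ Adj H j j) (φ : Contraction G G')
         (π-fibre-adj : ∀ {a p q} → p ≢ q → Contraction.π φ p ≡ Contraction.π φ q →
                        Adj G a p → Adj G a q → ⊥) where
  open Contraction φ

  fibre-dist2-□ : ∀ {a b p q j} → p ≢ q → π p ≡ π q →
                  Dist2-□ G H a b p j → Dist2-□ G H a b q j → ⊥
  fibre-dist2-□ p≢q πp≡πq (horizontal a·p) (horizontal a·q) = π-fibre p≢q πp≡πq a·p a·q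
  fibre-dist2-□ p≢q πp≡πq (diagonal a~p _) (diagonal a~q _)   = π-fibre-adj p≢q πp≡πq a~p a~q
  fibre-dist2-□ p≢q _ (vertical _) (vertical _)                 = p≢q refl
  fibre-dist2-□ _ _ (horizontal _) (vertical (b≢b , _))         = b≢b refl
  fibre-dist2-□ _ _ (vertical (b≢b , _)) (horizontal _)         = b≢b refl
  fibre-dist2-□ _ _ (horizontal _) (diagonal _ b~b)             = H-loopless _ b~b
  fibre-dist2-□ _ _ (diagonal _ b~b) (horizontal _)             = H-loopless _ b~b
  fibre-dist2-□ _ _ (vertical (_ , ¬b~j , _)) (diagonal _ b~j)  = ¬b~j b~j
  fibre-dist2-□ _ _ (diagonal _ b~j) (vertical (_ , ¬b~j , _))  = ¬b~j b~j

  π□ : V G × V H → V G' × V H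
  π□ (a , b) = π a , b

  π□-adj : ∀ {x y} → Adj (G □ H) x y → π□ x ≡ π□ y ⊎ Adj (G' □ H) (π□ x) (π□ y)
  π□-adj {_ , _} {_ , _} (inj₁ (refl , b~d)) = inj₂ (inj₁ (refl , b~d))
  π□-adj {_ , b} {_ , _} (inj₂ (refl , a~c)) = Sum.map (cong (_, b)) (inj₂ ∘ (refl ,_)) (π-adj a~c)

  π□-fibre : ∀ {v u₁ u₂} → u₁ ≢ u₂ → π□ u₁ ≡ π□ u₂ → Dist2 (G □ H) v u₁ → Dist2 (G □ H) v u₂ → ⊥
  π□-fibre {_ , _} {_ , _} {_ , _} u₁≢u₂ πu₁≡πu₂ d₁ d₂ with cong proj₂ πu₁≡πu₂
  ... | refl = fibre-dist2-□ (u₁≢u₂ ∘ cong (_, _)) (cong proj₁ πu₁≡πu₂) (dist2-□ d₁) (dist2-□ d₂)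

  □-contraction : Contraction (G □ H) (G' □ H)
  □-contraction = record
    { π       = π□
    ; σ       = λ (a , b) → σ a , b
    ; π∘σ     = λ (a , b) → cong (_, b) (π∘σ a)
    ; π-adj   = π□-adj
    ; π-fibre = π□-fibre
    }

swap-contraction : ∀ G H → Contraction (G □ H) (H □ G)
swap-contraction G H = record
  { π       = swap
  ; σ       = swap
  ; π∘σ     = λ _ → refl
  ; π-adj   = swap-adj
  ; π-fibre = λ u₁≢u₂ swap-u₁≡swap-u₂ _ _ → u₁≢u₂ (cong swap swap-u₁≡swap-u₂)
  }
  where
  swap-adj : ∀ {x y} → Adj (G □ H) x y → swap x ≡ swap y ⊎ Adj (H □ G) (swap x) (swap y)
  swap-adj {_ , _} {_ , _} (inj₁ a≡c×b~d) = inj₂ (inj₂ a≡c×b~d)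
  swap-adj {_ , _} {_ , _} (inj₂ b≡d×a~c) = inj₂ (inj₁ b≡d×a~c)

□-adj? : ∀ {G H} → DecidableEquality (V G) → DecidableEquality (V H) →
         Decidable (Adj G) → Decidable (Adj H) → Decidable (Adj (G □ H))
□-adj? _≟G_ _≟H_ G-adj? H-adj? (a , b) (c , d) =
  ((a ≟G c) ×-dec H-adj? b d) ⊎-dec ((b ≟H d) ×-dec G-adj? a c)

-- CycAdj k i j unfolds to CycAdjℕ k (toℕ i) (toℕ j); on ℕ the vertices can be matched against refl.
CycAdjℕ : ℕ → ℕ → ℕ → Set
CycAdjℕ k i j =
  (suc i ≡ j) ⊎ (suc j ≡ i) ⊎ ((i ≡ 0) × (suc j ≡ k)) ⊎ ((j ≡ 0) × (suc i ≡ k))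

cycAdjℕ? : ∀ k → Decidable (CycAdjℕ k)
cycAdjℕ? k i j =
  (suc i ℕ.≟ j) ⊎-dec (suc j ℕ.≟ i) ⊎-dec ((i ℕ.≟ 0) ×-dec (suc j ℕ.≟ k)) ⊎-dec ((j ℕ.≟ 0) ×-dec (suc i ℕ.≟ k))

cycAdj? : ∀ k → Decidable (CycAdj k)
cycAdj? k i j = cycAdjℕ? k (toℕ i) (toℕ j)

torus-adj? : ∀ k l → Decidable (Adj (C k □ C l))
torus-adj? k l = □-adj? _≟_ _≟_ (cycAdj? k) (cycAdj? l)

CycAdjℕ-irrefl : ∀ {k j} → ¬ CycAdjℕ (2 + k) j j
CycAdjℕ-irrefl (inj₁ ())
CycAdjℕ-irrefl (inj₂ (inj₁ ()))
CycAdjℕ-irrefl (inj₂ (inj₂ (inj₁ (refl , ()))))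
CycAdjℕ-irrefl (inj₂ (inj₂ (inj₂ (refl , ()))))

CycAdjℕ-interior : ∀ {k a j} → suc (suc j) ≢ k → CycAdjℕ k a (suc j) → a ≡ j ⊎ a ≡ suc (suc j)
CycAdjℕ-interior _ (inj₁ refl)                       = inj₁ refl
CycAdjℕ-interior _ (inj₂ (inj₁ refl))                = inj₂ refl
CycAdjℕ-interior 2+j≢k (inj₂ (inj₂ (inj₁ (_ , e))))  = ⊥-elim (2+j≢k e)
CycAdjℕ-interior _ (inj₂ (inj₂ (inj₂ (() , _))))

CycAdjℕ-zero : ∀ {k a} → CycAdjℕ (2 + k) a 0 → a ≡ 1 ⊎ a ≡ suc k
CycAdjℕ-zero (inj₂ (inj₁ refl))                = inj₁ refl
CycAdjℕ-zero (inj₂ (inj₂ (inj₂ (_ , refl))))   = inj₂ refl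
CycAdjℕ-zero (inj₂ (inj₂ (inj₁ (_ , ()))))

CycAdjℕ-last : ∀ {k a} → a < 2 + k → CycAdjℕ (2 + k) a (suc k) → a ≡ k ⊎ a ≡ 0
CycAdjℕ-last _ (inj₁ refl)                        = inj₁ refl
CycAdjℕ-last a<a (inj₂ (inj₁ refl))               = ⊥-elim (<-irrefl refl a<a)
CycAdjℕ-last _ (inj₂ (inj₂ (inj₁ (refl , _))))    = inj₂ refl
CycAdjℕ-last _ (inj₂ (inj₂ (inj₂ (() , _))))

mergeLast : ∀ {L} → Fin (2 + L) → Fin (suc L)
mergeLast {zero}  _       = zero
mergeLast {suc L} zero    = zero
mergeLast {suc L} (suc x) = suc (mergeLast x)

mergeLast-inject₁ : ∀ {L} (x : Fin (suc L)) → mergeLast (inject₁ x) ≡ x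
mergeLast-inject₁ {zero}  zero    = refl
mergeLast-inject₁ {suc L} zero    = refl
mergeLast-inject₁ {suc L} (suc x) = cong suc (mergeLast-inject₁ x)

data MergeLast (L : ℕ) : ℕ → ℕ → Set where
  last : MergeLast L (suc L) L
  kept : ∀ {a} → a ≤ L → MergeLast L a a

MergeLast-suc : ∀ {L a a'} → MergeLast L a a' → MergeLast (suc L) (suc a) (suc a')
MergeLast-suc last       = last
MergeLast-suc (kept a≤L) = kept (ℕ.s≤s a≤L)

mergeLast-view : ∀ {L} (x : Fin (2 + L)) → MergeLast L (toℕ x) (toℕ (mergeLast x))
mergeLast-view {zero}  zero       = kept ℕ.z≤n
mergeLast-view {zero}  (suc zero) = last
mergeLast-view {suc L} zero       = kept ℕ.z≤n
mergeLast-view {suc L} (suc x)    = MergeLast-suc (mergeLast-view x)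

MergeLast-adj : ∀ {L a a' b b'} → MergeLast L a a' → MergeLast L b b' →
             CycAdjℕ (2 + L) a b → a' ≡ b' ⊎ CycAdjℕ (suc L) a' b'
MergeLast-adj last     (kept b≤L) (inj₁ refl)   = ⊥-elim (≤⇒≯ (n≤1+n _) b≤L)
MergeLast-adj (kept _) last       (inj₁ refl)   = inj₁ refl
MergeLast-adj (kept _) (kept _)   (inj₁ refl)   = inj₂ (inj₁ refl)
MergeLast-adj (kept a≤L) last     (inj₂ (inj₁ refl)) = ⊥-elim (≤⇒≯ (n≤1+n _) a≤L)
MergeLast-adj last     (kept _)   (inj₂ (inj₁ refl)) = inj₁ refl
MergeLast-adj (kept _) (kept _)   (inj₂ (inj₁ refl)) = inj₂ (inj₂ (inj₁ refl))
MergeLast-adj (kept _) last       (inj₂ (inj₂ (inj₁ (refl , refl)))) = inj₂ (inj₂ (inj₂ (inj₁ (refl , refl))))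
MergeLast-adj _        (kept b≤L) (inj₂ (inj₂ (inj₁ (_ , refl))))    = ⊥-elim (1+n≰n b≤L)
MergeLast-adj last     (kept _)   (inj₂ (inj₂ (inj₂ (refl , refl)))) = inj₂ (inj₂ (inj₂ (inj₂ (refl , refl))))
MergeLast-adj (kept a≤L) _        (inj₂ (inj₂ (inj₂ (_ , refl))))    = ⊥-elim (1+n≰n a≤L)
MergeLast-adj last     last       (inj₂ (inj₂ (inj₁ (() , _))))
MergeLast-adj last     last       (inj₂ (inj₂ (inj₂ (() , _))))

MergeLast-fibre : ∀ {L a b c} → MergeLast L a c → MergeLast L b c → a ≢ b →
               (a ≡ L × b ≡ suc L) ⊎ (a ≡ suc L × b ≡ L)
MergeLast-fibre last     last     a≢a = ⊥-elim (a≢a refl)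
MergeLast-fibre last     (kept _) _   = inj₂ (refl , refl)
MergeLast-fibre (kept _) last     _   = inj₁ (refl , refl)
MergeLast-fibre (kept _) (kept _) a≢a = ⊥-elim (a≢a refl)

mergeLast-adj : ∀ {L} {x y : Fin (2 + L)} → CycAdj (2 + L) x y →
                mergeLast x ≡ mergeLast y ⊎ CycAdj (suc L) (mergeLast x) (mergeLast y)
mergeLast-adj {x = x} {y} x~y = Sum.map₁ toℕ-injective (MergeLast-adj (mergeLast-view x) (mergeLast-view y) x~y)

mergeLast-fibre : ∀ {L} {x y : Fin (2 + L)} → x ≢ y → mergeLast x ≡ mergeLast y →
                  (toℕ x ≡ L × toℕ y ≡ suc L) ⊎ (toℕ x ≡ suc L × toℕ y ≡ L)
mergeLast-fibre {L} {x} {y} x≢y x≈y =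
  MergeLast-fibre (mergeLast-view x) (subst (MergeLast L (toℕ y)) (cong toℕ (sym x≈y)) (mergeLast-view y))
               (x≢y ∘ toℕ-injective)

module _ {t : ℕ} where
  two-step-to-4+t : ∀ {a w} → a < 6 + t → a ≢ 4 + t →
                    CycAdjℕ (6 + t) a w → CycAdjℕ (6 + t) w (4 + t) → a ≡ 2 + t ⊎ a ≡ 0
  two-step-to-4+t a<6+t a≢ a~w w~p with CycAdjℕ-interior (λ ()) w~p
  ... | inj₁ refl = inj₁ (fromInj₁ (⊥-elim ∘ a≢) (CycAdjℕ-interior (λ ()) a~w))
  ... | inj₂ refl = inj₂ (fromInj₂ (⊥-elim ∘ a≢) (CycAdjℕ-last a<6+t a~w))

  two-step-to-5+t : ∀ {a w} → w < 6 + t → a ≢ 5 + t →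
                    CycAdjℕ (6 + t) a w → CycAdjℕ (6 + t) w (5 + t) → a ≡ 3 + t ⊎ a ≡ 1
  two-step-to-5+t w<6+t a≢ a~w w~q with CycAdjℕ-last w<6+t w~q
  ... | inj₁ refl = inj₁ (fromInj₁ (⊥-elim ∘ a≢) (CycAdjℕ-interior (λ ()) a~w))
  ... | inj₂ refl = inj₂ (fromInj₁ (⊥-elim ∘ a≢) (CycAdjℕ-zero a~w))

  module _ {p q : Fin (6 + t)} (p≡4+t : toℕ p ≡ 4 + t) (q≡5+t : toℕ q ≡ 5 + t) where
    last-edge-no-common-adj : ∀ {a} → CycAdj (6 + t) a p → CycAdj (6 + t) a q → ⊥
    last-edge-no-common-adj {a} a~p a~q
      with toℕ a | CycAdjℕ-interior (λ ()) (subst (CycAdjℕ _ (toℕ a)) p≡4+t a~p)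
                 | CycAdjℕ-last (toℕ<n a) (subst (CycAdjℕ _ (toℕ a)) q≡5+t a~q)
    ... | _ | inj₁ refl | inj₁ ()
    ... | _ | inj₁ refl | inj₂ ()
    ... | _ | inj₂ refl | inj₁ ()
    ... | _ | inj₂ refl | inj₂ ()

    last-edge-no-common-dist2 : ∀ {a} → Dist2 (C (6 + t)) a p → Dist2 (C (6 + t)) a q → ⊥
    last-edge-no-common-dist2 {a} (p≢a , _ , w , a~w , w~p) (q≢a , _ , w' , a~w' , w'~q)
      with toℕ a | two-step-to-4+t (toℕ<n a) (≢-toℕ p≡4+t p≢a) a~w (subst (CycAdjℕ _ (toℕ w)) p≡4+t w~p)
                 | two-step-to-5+t (toℕ<n w') (≢-toℕ q≡5+t q≢a) a~w' (subst (CycAdjℕ _ (toℕ w')) q≡5+t w'~q)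
      where ≢-toℕ : ∀ {u k} → toℕ u ≡ k → u ≢ a → toℕ a ≢ k
            ≢-toℕ u≡k u≢a a≡k = u≢a (toℕ-injective (trans u≡k (sym a≡k)))
    ... | _ | inj₁ refl | inj₁ ()
    ... | _ | inj₁ refl | inj₂ ()
    ... | _ | inj₂ refl | inj₁ ()
    ... | _ | inj₂ refl | inj₂ ()

  mergeLast-fibre-no-common-adj : ∀ {a x y : Fin (6 + t)} → x ≢ y → mergeLast x ≡ mergeLast y →
                                  CycAdj (6 + t) a x → CycAdj (6 + t) a y → ⊥
  mergeLast-fibre-no-common-adj x≢y x≈y a~x a~y with mergeLast-fibre x≢y x≈y
  ... | inj₁ (x≡ , y≡) = last-edge-no-common-adj x≡ y≡ a~x a~y
  ... | inj₂ (x≡ , y≡) = last-edge-no-common-adj y≡ x≡ a~y a~x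

  mergeLast-fibre-no-common-dist2 : ∀ {a x y : Fin (6 + t)} → x ≢ y → mergeLast x ≡ mergeLast y →
                                    Dist2 (C (6 + t)) a x → Dist2 (C (6 + t)) a y → ⊥
  mergeLast-fibre-no-common-dist2 x≢y x≈y a·x a·y with mergeLast-fibre x≢y x≈y
  ... | inj₁ (x≡ , y≡) = last-edge-no-common-dist2 x≡ y≡ a·x a·y
  ... | inj₂ (x≡ , y≡) = last-edge-no-common-dist2 y≡ x≡ a·y a·x

  cycle-contraction : Contraction (C (6 + t)) (C (5 + t))
  cycle-contraction = record
    { π       = mergeLast
    ; σ       = inject₁
    ; π∘σ     = mergeLast-inject₁
    ; π-adj   = mergeLast-adj
    ; π-fibre = mergeLast-fibre-no-common-dist2
    }

torus-contraction : ∀ t l → C (5 + t) □ C (6 + l) ≼ᵈ C (6 + t) □ C (6 + l)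
torus-contraction t l =
  contraction⇒≼ᵈ (≡-dec _≟_ _≟_) (torus-adj? _ _)
    (□-contraction (C (6 + l)) (λ _ → CycAdjℕ-irrefl) cycle-contraction mergeLast-fibre-no-common-adj)

torus-swap : ∀ k l → C l □ C k ≼ᵈ C k □ C l
torus-swap k l = contraction⇒≼ᵈ (≡-dec _≟_ _≟_) (torus-adj? l k) (swap-contraction (C k) (C l))

lemma2p3 : (m n : ℕ) → 6 ≤ m → 6 ≤ n →
    (a b c : ℕ) →
    IsDisjDomNumber (C (m ∸ 1) □ C n) a →
    IsDisjDomNumber (C m □ C (n ∸ 1)) b →
    IsDisjDomNumber (C m □ C n) c →
    a ⊔ b ≤ c
lemma2p3 m n 6≤m 6≤n a b c γa γb γc with m≤n⇒∃[o]m+o≡n 6≤m | m≤n⇒∃[o]m+o≡n 6≤n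
... | t , refl | r , refl = ⊔-lub (disjDomNumber-mono shrink-first γa γc) (disjDomNumber-mono shrink-second γb γc)
  where
  shrink-first : C (5 + t) □ C (6 + r) ≼ᵈ C (6 + t) □ C (6 + r)
  shrink-first = torus-contraction t r

  shrink-second : C (6 + t) □ C (5 + r) ≼ᵈ C (6 + t) □ C (6 + r)
  shrink-second = ≼ᵈ-trans (torus-swap (5 + r) (6 + t))
                 (≼ᵈ-trans (torus-contraction r t) (torus-swap (6 + t) (6 + r)))
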